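{- Let $n\ge1$, $0\le j\le n$, and let $[l]\in\mathrm{Orb}(C_n,\mathrm{Neck}(n,j))^f$ be a flip-invariant rotation orbit of necklaces, with period $\pi([l])$. If $\frac{n}{\pi([l])}$ is odd, then $[l]$ has a unique symmetry axis. Otherwise, $[l]$ has two distinct symmetry axes $[(l_1,\sigma_1)]$ and $[(l_2,\sigma_2)]$ with $d([(l_1,\sigma_1)],[(l_2,\sigma_2)]) = \frac{\pi([l])}{2}$.
   Context: Place $n$ beads at the points $P_m=R^m(0,1)\in\mathbb R^2$, $m\in\mathbb Z/n$, where $R$ is counterclockwise rotation by $2\pi/n$. $\mathrm{Neck}(n,j)$ is the set of colorings of these $n$ positions with $j$ blue and $n-j$ red beads (equivalently $j$-subsets of $\mathbb Z/n$). The cyclic group $C_n=\langle r\rangle$ acts by rotation ($r$ moves each bead from $P_m$ to $P_{m+1}$), and the flip $f$ acts by reflection in the vertical axis ($P_m\mapsto P_{ -m}$); $f$ induces an involution on the set $\mathrm{Orb}(C_n,\mathrm{Neck}(n,j))$ of $C_n$-orbits, and $\mathrm{Orb}(C_n,\mathrm{Neck}(n,j))^f$ denotes the set of orbits fixed by it. The period $\pi([l])$ is the cardinality of the orbit $[l]$. For a necklace $l$, a line $\sigma$ through the origin is a symmetry axis of $l$ if the reflection of $\mathbb R^2$ in $\sigma$ maps the set of blue positions of $l$ to itself. A symmetry axis of an orbit $[l]$ is the $C_n$-orbit $[(l',\sigma)]$ of a pair $(l',\sigma)$ with $l'\in[l]$ and $\sigma$ a symmetry axis of $l'$, where $r$ acts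 on pairs by rotating both the necklace and the line by $2\pi/n$. The distance $d([(l_1,\sigma_1)],[(l_2,\sigma_2)])$ between two symmetry axes of $[l]$ is the minimum of $|m|$ over half-integers $m\in\frac12\mathbb Z$ for which there are representatives $(l',\sigma_1')$, $(l',\sigma_2')$ of the two axes (with a common necklace $l'$) such that rotating $\sigma_1'$ counterclockwise by the angle $2\pi m/n$ gives $\sigma_2'$. -}

module Defs where

open import Data.Nat using (ℕ; suc; NonZero)
open import Data.Integer using (ℤ; +_; _+_; _-_; -_; _%ℕ_; ∣_∣)
open import Data.Integer.DivMod using (n%ℕd<d)
open import Data.Fin using (Fin; toℕ; fromℕ<)
open import Data.Fin.Subset using (Subset; Side; inside; outside)
open import Data.Bool.Properties using () renaming (_≟_ to _≟ᵇ_)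
open import Data.Vec.Properties using (≡-dec)
open import Data.Vec using (Vec; lookup; tabulate)
open import Data.List using (List; length; map; upTo; deduplicate)
open import Data.Product using (Σ; ∃; _×_; _,_)
open import Relation.Binary.PropositionalEquality using (_≡_)
open import Relation.Nullary using (¬_)
open import Function.Bundles using (_⇔_)

-- Positions are Z/n, represented by Fin n (index m is the point P_m = R^m(0,1)).
-- A necklace is a coloring: 'inside' = blue, 'outside' = red.
Necklace : ℕ → Set
Necklace n = Subset n

idx : (n : ℕ) .{{_ : NonZero n}} → ℤ → Fin n
idx n z = fromℕ< (n%ℕd<d z n)

pos : {n : ℕ} → Fin n → ℤ
pos m = + toℕ m

-- r : the bead at P_m moves to P_(m+1), i.e. (r l)(m) = l(m - 1)
rot : {n : ℕ} .{{_ : NonZero n}} → Necklace n → Necklace n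
rot {n} l = tabulate (λ m → lookup l (idx n (pos m - + 1)))

rotN : {n : ℕ} .{{_ : NonZero n}} → ℕ → Necklace n → Necklace n
rotN 0 l = l
rotN (suc t) l = rot (rotN t l)

flip : {n : ℕ} .{{_ : NonZero n}} → Necklace n → Necklace n
flip {n} l = tabulate (λ m → lookup l (idx n (- pos m)))

blues : {n : ℕ} → Necklace n → ℕ
blues = Data.Fin.Subset.∣_∣

InOrb : {n : ℕ} .{{_ : NonZero n}} → Necklace n → Necklace n → Set
InOrb l l' = ∃ λ (t : ℕ) → l' ≡ rotN t l

FlipInvariant : {n : ℕ} .{{_ : NonZero n}} → Necklace n → Set
FlipInvariant l = InOrb l (flip l)

period : {n : ℕ} .{{_ : NonZero n}} → Necklace n → ℕ
period {n} l = length (deduplicate (≡-dec _≟ᵇ_) (map (λ t → rotN t l) (upTo n)))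

-- Lines: the line σ_s (s ∈ Z/n) through the origin at angle π/2 + π s / n.  Rotating σ_s counterclockwise by
-- the angle 2π m / n (m ∈ ½Z) gives σ_(s + 2m).
reflect : {n : ℕ} .{{_ : NonZero n}} → Fin n → Fin n → Fin n
reflect {n} s m = idx n (pos s - pos m)

IsAxis : {n : ℕ} .{{_ : NonZero n}} → Necklace n → Fin n → Set
IsAxis l s = ∀ m → (lookup l m ≡ inside) ⇔ (lookup l (reflect s m) ≡ inside)

-- rotate the line σ_s by the angle 2π k / (2n), k ∈ ℤ (i.e. by m = k/2)
rotLine : {n : ℕ} .{{_ : NonZero n}} → ℤ → Fin n → Fin n
rotLine {n} k s = idx n (pos s + k)

AxisPair : {n : ℕ} .{{_ : NonZero n}} → Necklace n → Set
AxisPair {n} l = Σ (Necklace n × Fin n) λ { (l' , s) → InOrb l l' × IsAxis l' s }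

SameOrbit : {n : ℕ} .{{_ : NonZero n}} → Necklace n × Fin n → Necklace n × Fin n → Set
SameOrbit (l₁ , s₁) (l₂ , s₂) =
  ∃ λ (t : ℕ) → (l₂ ≡ rotN t l₁) × (s₂ ≡ rotLine (+ (2 Data.Nat.* t)) s₁)

SameAxis : {n : ℕ} .{{_ : NonZero n}} {l : Necklace n} → AxisPair l → AxisPair l → Set
SameAxis (p , _) (q , _) = SameOrbit p q

Realizes : {n : ℕ} .{{_ : NonZero n}} {l : Necklace n} → AxisPair l → AxisPair l → ℤ → Set
Realizes {n} (a , _) (b , _) k =
  ∃ λ (l' : Necklace n) → ∃ λ (s₁ : Fin n) → ∃ λ (s₂ : Fin n) →
    SameOrbit a (l' , s₁) × SameOrbit b (l' , s₂) × (s₂ ≡ rotLine k s₁)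

-- 2 · d(A, B) ≡ D : D is the minimum of ∣k∣ = 2|m| over realizing m = k/2
TwiceDistance : {n : ℕ} .{{_ : NonZero n}} {l : Necklace n} → AxisPair l → AxisPair l → ℕ → Set
TwiceDistance A B D =
  (∃ λ k → Realizes A B k × ∣ k ∣ ≡ D) × (∀ k → Realizes A B k → D Data.Nat.≤ ∣ k ∣)

{-# OPTIONS --safe #-}
module Submission where

-- Read a necklace l as the n-periodic colouring z ↦ colour l z of ℤ. Its periods form a
-- subgroup p₀ℤ of ℤ, p₀ the least positive period, and p₀ is also the size of the orbit [l].
-- Its symmetry axes are the c with colour l (c - z) = colour l z for all z: two axes differ by
-- a period and an axis plus a period is an axis, so the axes of l form one coset c₀ + p₀ℤ,
-- which is non-empty because f l = r^t₀ l makes c₀ = -t₀ an axis.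
-- Since (r^t l , σ_s) = r^t (l , σ_(s-2t)), every axis pair of [l] comes from an axis s - 2t
-- of l itself, and two pairs are the same axis of [l] iff these base axes differ by an element
-- of 2p₀ℤ + nℤ. If n/p₀ is odd, this subgroup is p₀ℤ and [l] has a single axis. If n/p₀ is even,
-- it is 2p₀ℤ: there are exactly the two axes through c₀ and c₀ + p₀, and every rotation k
-- (in half-steps) carrying one to the other is ≡ p₀ modulo 2p₀, so |k| ≥ p₀, with equality
-- for k = p₀.

open import Defs
open import Data.Bool using (Bool; true; false)
open import Data.Bool.Properties using () renaming (_≟_ to _≟ᵇ_)
open import Data.Fin using (Fin; toℕ)
import Data.Fin.Properties as FinP
open import Data.Integer using (ℤ; +_; -_; ∣_∣; 0ℤ)
import Data.Integer.Properties as ℤP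
open import Data.Integer.Divisibility.Signed using (divides) renaming (_∣_ to _∣ℤ_)
open import Data.Integer.Tactic.RingSolver using (solve-∀)
open import Data.List using (List; length; map; upTo; applyUpTo; deduplicate)
open import Data.List.Properties using (length-applyUpTo)
open import Data.List.Membership.Propositional using (_∈_)
open import Data.List.Membership.Propositional.Properties
  using (∈-map⁺; ∈-map⁻; ∈-upTo⁺; ∈-applyUpTo⁺; ∈-applyUpTo⁻; deduplicate-∈⇔)
open import Data.List.Membership.Propositional.Properties.WithK using (unique∧set⇒bag)
open import Data.List.Relation.Binary.BagAndSetEquality using (∼bag⇒↭)
open import Data.List.Relation.Binary.Permutation.Propositional.Properties using (↭-length)
open import Data.List.Relation.Unary.Unique.Propositional using (Unique)
open import Data.List.Relation.Unary.Unique.Propositional.Properties using (applyUpTo⁺₁)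
import Data.List.Relation.Unary.Unique.DecPropositional.Properties as UniqueDec
import Data.Nat as Nat
open Nat using (ℕ; NonZero; suc; zero)
import Data.Nat.Properties as NatP
import Data.Nat.Divisibility as NatDiv
import Data.Nat.DivMod as NatDivMod
open import Data.Product using (Σ; ∃; _×_; _,_; proj₁; proj₂)
open import Data.Sum using (_⊎_; inj₁; inj₂)
import Data.Sum as Sum
open import Data.Vec.Properties using (≡-dec)
open import Function using (_∘_)
open import Function.Bundles using (_⇔_; mk⇔; Equivalence)
open import Function.Construct.Composition using (_⇔-∘_)
open import Relation.Binary.Definitions using (DecidableEquality)
open import Relation.Binary.PropositionalEquality
open import Relation.Nullary using (¬_; yes; no; contradiction)
open import Relation.Unary using (Decidable)

leastWitness : ∀ {p} {P : ℕ → Set p} → Decidable P → ∀ {n} → P n →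
               ∃ λ m → P m × (∀ {k} → k Nat.< m → ¬ P k)
leastWitness P? {zero} P0 = 0 , P0 , λ ()
leastWitness P? {suc n} P1+n with P? 0
... | yes P0 = 0 , P0 , λ ()
... | no ¬P0 with leastWitness (P? ∘ suc) P1+n
...   | m , Pm , below = suc m , Pm , λ { {zero} _ → ¬P0 ; {suc k} k<m → below (Nat.s<s⁻¹ k<m) }

length-deduplicate : ∀ {a} {A : Set a} (_≟_ : DecidableEquality A) {xs ys : List A} →
                     Unique ys → (∀ {x} → x ∈ xs ⇔ x ∈ ys) →
                     length (deduplicate _≟_ xs) ≡ length ys
length-deduplicate _≟_ {xs} ys! xs⇔ys =
  ↭-length (∼bag⇒↭ (unique∧set⇒bag (UniqueDec.deduplicate-! _≟_ xs) ys!
    (mk⇔ (Equivalence.to xs⇔ys ∘ Equivalence.from (deduplicate-∈⇔ _≟_))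
         (Equivalence.to (deduplicate-∈⇔ _≟_) ∘ Equivalence.from xs⇔ys))))

≡true⇔⇒≡ : ∀ {b c : Bool} → (b ≡ true) ⇔ (c ≡ true) → b ≡ c
≡true⇔⇒≡ {false} {false} _   = refl
≡true⇔⇒≡ {false} {true}  b⇔c = Equivalence.from b⇔c refl
≡true⇔⇒≡ {true}  {false} b⇔c = sym (Equivalence.to b⇔c refl)
≡true⇔⇒≡ {true}  {true}  _   = refl

¬2∣⇒≡1+2* : ∀ {q} → ¬ 2 NatDiv.∣ q → ∃ λ h → q ≡ suc (2 Nat.* h)
¬2∣⇒≡1+2* {q} ¬2∣q with q Nat.% 2 | NatDivMod.m%n<n q 2 | NatDivMod.m≡m%n+[m/n]*n q 2
... | 0           | _                     | q≡ = contradiction (NatDiv.divides (q Nat./ 2) q≡) ¬2∣q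
... | 1           | _                     | q≡ = q Nat./ 2 , trans q≡ (cong suc (NatP.*-comm (q Nat./ 2) 2))
... | suc (suc _) | Nat.s≤s (Nat.s≤s ()) | _

module _ where
  open import Data.Integer using (_+_; _-_; _*_; _%ℕ_; _/ℕ_)
  open import Data.Integer.DivMod using (n%ℕd<d; a≡a%ℕn+[a/ℕn]*n)
  open import Data.Integer.Divisibility.Signed

  ∣∧∣∣<⇒≡0 : ∀ {d x} → d ∣ℤ x → ∣ x ∣ Nat.< ∣ d ∣ → x ≡ 0ℤ
  ∣∧∣∣<⇒≡0 {d} {x} d∣x ∣x∣<∣d∣ = ℤP.∣i∣≡0⇒i≡0 (smallMultiple (∣⇒∣ᵤ d∣x) ∣x∣<∣d∣)
    where
    smallMultiple : ∀ {m} → ∣ d ∣ NatDiv.∣ m → m Nat.< ∣ d ∣ → m ≡ 0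
    smallMultiple {zero}  _     _     = refl
    smallMultiple {suc _} ∣d∣∣m m<∣d∣ = contradiction (NatDiv.∣⇒≤ ∣d∣∣m) (NatP.<⇒≱ m<∣d∣)

  ∣z%ℕd-z : ∀ z d .{{_ : NonZero d}} → + d ∣ℤ + (z %ℕ d) - z
  ∣z%ℕd-z z d = divides (- (z /ℕ d)) (begin
    + (z %ℕ d) - z                           ≡⟨ cong (λ w → + (z %ℕ d) - w) (a≡a%ℕn+[a/ℕn]*n z d) ⟩
    + (z %ℕ d) - (+ (z %ℕ d) + z /ℕ d * + d) ≡⟨ cancel (+ (z %ℕ d)) (z /ℕ d) (+ d) ⟩
    - (z /ℕ d) * + d                         ∎)
    where
    open ≡-Reasoning
    cancel : ∀ r q d → r - (r + q * d) ≡ - q * d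
    cancel = solve-∀

  ∣+a-+b∣< : ∀ {a b k} → a Nat.< k → b Nat.< k → ∣ + a - + b ∣ Nat.< k
  ∣+a-+b∣< {a} {b} a<k b<k = NatP.≤-<-trans
    (subst (Nat._≤ a Nat.⊔ b) (cong ∣_∣ (sym (ℤP.m-n≡m⊖n a b))) (ℤP.∣m⊝n∣≤m⊔n a b))
    (NatP.⊔-lub a<k b<k)

  1+2*≢0 : ∀ c → + 1 + + 2 * c ≢ 0ℤ
  1+2*≢0 c 1+2c≡0 = contradiction (∣∧∣∣<⇒≡0 (divides (- c) 1≡-c*2) (Nat.s≤s (Nat.s≤s Nat.z≤n))) λ ()
    where
    rearrange : ∀ c → + 1 ≡ (+ 1 + + 2 * c) + (- c) * + 2
    rearrange = solve-∀
    1≡-c*2 : + 1 ≡ (- c) * + 2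
    1≡-c*2 = trans (rearrange c) (trans (cong (_+ (- c) * + 2) 1+2c≡0) (ℤP.+-identityˡ _))

  2p∣k-p⇒∣p∣≤∣k∣ : ∀ {p k} → + 2 * p ∣ℤ k - p → ∣ p ∣ Nat.≤ ∣ k ∣
  2p∣k-p⇒∣p∣≤∣k∣ {p} {k} (divides c k-p≡c*2p) = begin
    ∣ p ∣                         ≤⟨ NatP.m≤n*m ∣ p ∣ ∣ + 1 + + 2 * c ∣ {{∣1+2c∣≢0}} ⟩
    ∣ + 1 + + 2 * c ∣ Nat.* ∣ p ∣ ≡⟨ ℤP.abs-* (+ 1 + + 2 * c) p ⟨
    ∣ (+ 1 + + 2 * c) * p ∣       ≡⟨ cong ∣_∣ k≡[1+2c]p ⟨
    ∣ k ∣                         ∎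
    where
    open NatP.≤-Reasoning
    split : ∀ k p → k ≡ (k - p) + p
    split = solve-∀
    collect : ∀ c p → c * (+ 2 * p) + p ≡ (+ 1 + + 2 * c) * p
    collect = solve-∀
    k≡[1+2c]p : k ≡ (+ 1 + + 2 * c) * p
    k≡[1+2c]p = trans (split k p) (trans (cong (_+ p) k-p≡c*2p) (collect c p))
    ∣1+2c∣≢0 : NonZero ∣ + 1 + + 2 * c ∣
    ∣1+2c∣≢0 = Nat.≢-nonZero (1+2*≢0 c ∘ ℤP.∣i∣≡0⇒i≡0)

  p∣d⇒2p∣d⊎2p∣d-p : ∀ {p d} → p ∣ℤ d → + 2 * p ∣ℤ d ⊎ + 2 * p ∣ℤ d - p
  p∣d⇒2p∣d⊎2p∣d-p {p} (divides i refl) with i %ℕ 2 | n%ℕd<d i 2 | a≡a%ℕn+[a/ℕn]*n i 2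
  ... | 0 | _ | i≡ = inj₁ (divides (i /ℕ 2) (trans (cong (_* p) i≡) (even (i /ℕ 2) p)))
    where
    even : ∀ h p → (+ 0 + h * + 2) * p ≡ h * (+ 2 * p)
    even = solve-∀
  ... | 1 | _ | i≡ = inj₂ (divides (i /ℕ 2) (trans (cong (λ i → i * p - p) i≡) (odd (i /ℕ 2) p)))
    where
    odd : ∀ h p → (+ 1 + h * + 2) * p - p ≡ h * (+ 2 * p)
    odd = solve-∀
  ... | suc (suc _) | Nat.s≤s (Nat.s≤s ()) | _

  infix 4 _∈⟨_,_⟩
  record _∈⟨_,_⟩ (d a b : ℤ) : Set where
    constructor combination
    field
      x y      : ℤ
      equality : d ≡ x * a + y * b

  module _ {a b : ℤ} where

    ∈⟨⟩ˡ : ∀ {d} → a ∣ℤ d → d ∈⟨ a , b ⟩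
    ∈⟨⟩ˡ (divides x refl) = combination x 0ℤ (sym (ℤP.+-identityʳ (x * a)))

    ∈⟨⟩ʳ : ∀ {d} → b ∣ℤ d → d ∈⟨ a , b ⟩
    ∈⟨⟩ʳ (divides y refl) = combination 0ℤ y (sym (ℤP.+-identityˡ (y * b)))

    ∈⟨⟩-+ : ∀ {d e} → d ∈⟨ a , b ⟩ → e ∈⟨ a , b ⟩ → d + e ∈⟨ a , b ⟩
    ∈⟨⟩-+ (combination x y refl) (combination x′ y′ refl) =
      combination (x + x′) (y + y′) (collect x y x′ y′ a b)
      where
      collect : ∀ x y x′ y′ a b →
        (x * a + y * b) + (x′ * a + y′ * b) ≡ (x + x′) * a + (y + y′) * b
      collect = solve-∀

    ∈⟨⟩-- : ∀ {d e} → d ∈⟨ a , b ⟩ → e ∈⟨ a , b ⟩ → d - e ∈⟨ a , b ⟩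
    ∈⟨⟩-- (combination x y refl) (combination x′ y′ refl) =
      combination (x - x′) (y - y′) (collect x y x′ y′ a b)
      where
      collect : ∀ x y x′ y′ a b →
        (x * a + y * b) - (x′ * a + y′ * b) ≡ (x - x′) * a + (y - y′) * b
      collect = solve-∀

    ∈⟨⟩⇒∣ : ∀ {c d} → c ∣ℤ a → c ∣ℤ b → d ∈⟨ a , b ⟩ → c ∣ℤ d
    ∈⟨⟩⇒∣ c∣a c∣b (combination x y refl) = ∣m∣n⇒∣m+n (∣n⇒∣m*n x c∣a) (∣n⇒∣m*n y c∣b)

  p∣d⇒d∈⟨2p,[1+2h]p⟩ : ∀ {p n d} h → n ≡ (+ 1 + + 2 * h) * p → p ∣ℤ d → d ∈⟨ + 2 * p , n ⟩
  p∣d⇒d∈⟨2p,[1+2h]p⟩ {p} h refl (divides i refl) = combination (- (i * h)) i (split i h p)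
    where
    split : ∀ i h p → i * p ≡ - (i * h) * (+ 2 * p) + i * ((+ 1 + + 2 * h) * p)
    split = solve-∀

module _ {a} {A : Set a} where
  open import Data.Integer using (_+_; _-_)

  record Period (f : ℤ → A) (d : ℤ) : Set a where
    constructor periodic
    field translation-invariant : ∀ z → f (z + d) ≡ f z

  record Axis (f : ℤ → A) (c : ℤ) : Set a where
    constructor axis
    field reflection-invariant : ∀ z → f (c - z) ≡ f z

module Periodic {a} {A : Set a} (f : ℤ → A) where
  open import Data.Integer using (_+_; _-_; _*_; _%ℕ_; _/ℕ_; -[1+_])
  open import Data.Integer.DivMod using (n%ℕd<d; a≡a%ℕn+[a/ℕn]*n)
  open ≡-Reasoning

  period-+ : ∀ {d e} → Period f d → Period f e → Period f (d + e)
  period-+ {d} {e} (periodic d-periodic) (periodic e-periodic) = periodic λ z → begin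
    f (z + (d + e)) ≡⟨ cong f (ℤP.+-assoc z d e) ⟨
    f (z + d + e)   ≡⟨ e-periodic (z + d) ⟩
    f (z + d)       ≡⟨ d-periodic z ⟩
    f z             ∎

  period-neg : ∀ {d} → Period f d → Period f (- d)
  period-neg {d} (periodic d-periodic) = periodic λ z → begin
    f (z - d)     ≡⟨ d-periodic (z - d) ⟨
    f (z - d + d) ≡⟨ cong f (cancel z d) ⟩
    f z           ∎
    where
    cancel : ∀ z d → z - d + d ≡ z
    cancel = solve-∀

  period-*ℕ : ∀ k {d} → Period f d → Period f (+ k * d)
  period-*ℕ zero    _ = periodic λ z → cong f (ℤP.+-identityʳ z)
  period-*ℕ (suc k) {d} d-periodic =
    subst (Period f) (sym (ℤP.suc-* (+ k) d)) (period-+ d-periodic (period-*ℕ k d-periodic))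

  period-* : ∀ c {d} → Period f d → Period f (c * d)
  period-* (+ k)        d-periodic = period-*ℕ k d-periodic
  period-* -[1+ k ] {d} d-periodic =
    subst (Period f) (ℤP.neg-distribˡ-* (+ suc k) d) (period-neg (period-*ℕ (suc k) d-periodic))

  ∣⇒period : ∀ {p d} → Period f p → p ∣ℤ d → Period f d
  ∣⇒period p-periodic (divides c refl) = period-* c p-periodic

  period⇒∣ : ∀ {m d} → Period f (+ suc m) → (∀ {k} → k Nat.< m → ¬ Period f (+ suc k)) →
             Period f d → + suc m ∣ℤ d
  period⇒∣ {m} {d} p-periodic minimal d-periodic
    with d %ℕ suc m | n%ℕd<d d (suc m) | a≡a%ℕn+[a/ℕn]*n d (suc m)
  ... | zero  | _   | d≡ = divides (d /ℕ suc m) (trans d≡ (ℤP.+-identityˡ _))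
  ... | suc r | r<p | d≡ = contradiction r-periodic (minimal (Nat.s<s⁻¹ r<p))
    where
    remainder : ∀ r q p → (r + q * p) - q * p ≡ r
    remainder = solve-∀
    r-periodic : Period f (+ suc r)
    r-periodic = subst (Period f)
      (trans (cong (_- (d /ℕ suc m) * + suc m) d≡) (remainder (+ suc r) (d /ℕ suc m) (+ suc m)))
      (period-+ d-periodic (period-neg (period-* (d /ℕ suc m) p-periodic)))

  axis-period : ∀ {c d} → Axis f c → Period f d → Axis f (c + d)
  axis-period {c} {d} (axis c-axis) (periodic d-periodic) = axis λ z → begin
    f (c + d - z) ≡⟨ cong f (swap c d z) ⟩
    f (c - z + d) ≡⟨ d-periodic (c - z) ⟩
    f (c - z)     ≡⟨ c-axis z ⟩
    f z           ∎
    where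
    swap : ∀ c d z → c + d - z ≡ c - z + d
    swap = solve-∀

  axis-axis : ∀ {c c′} → Axis f c → Axis f c′ → Period f (c - c′)
  axis-axis {c} {c′} (axis c-axis) (axis c′-axis) = periodic λ z → begin
    f (z + (c - c′)) ≡⟨ cong f (swap z c c′) ⟩
    f (c - (c′ - z)) ≡⟨ c-axis (c′ - z) ⟩
    f (c′ - z)       ≡⟨ c′-axis z ⟩
    f z              ∎
    where
    swap : ∀ z c c′ → z + (c - c′) ≡ c - (c′ - z)
    swap = solve-∀

  axis-translate : ∀ {g : ℤ → A} t {c} → (∀ z → g z ≡ f (z - t)) → Axis g c → Axis f (c - + 2 * t)
  axis-translate {g} t {c} g≡f[-t] (axis c-axis) = axis λ z → begin
    f (c - + 2 * t - z) ≡⟨ cong f (swap c t z) ⟩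
    f (c - (z + t) - t) ≡⟨ g≡f[-t] (c - (z + t)) ⟨
    g (c - (z + t))     ≡⟨ c-axis (z + t) ⟩
    g (z + t)           ≡⟨ g≡f[-t] (z + t) ⟩
    f (z + t - t)       ≡⟨ cong f (cancel z t) ⟩
    f z                 ∎
    where
    swap : ∀ c t z → c - + 2 * t - z ≡ c - (z + t) - t
    swap = solve-∀
    cancel : ∀ z t → z + t - t ≡ z
    cancel = solve-∀

  reflection⇒axis : ∀ t → (∀ z → f (- z) ≡ f (z - t)) → Axis f (- t)
  reflection⇒axis t f[-z]≡f[z-t] = axis λ z → begin
    f (- t - z)   ≡⟨ cong f (swap t z) ⟩
    f (- (z + t)) ≡⟨ f[-z]≡f[z-t] (z + t) ⟩
    f (z + t - t) ≡⟨ cong f (cancel z t) ⟩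
    f z           ∎
    where
    swap : ∀ t z → - t - z ≡ - (z + t)
    swap = solve-∀
    cancel : ∀ z t → z + t - t ≡ z
    cancel = solve-∀

module Necklaces (n : ℕ) .{{_ : NonZero n}} where
  open import Data.Integer using (_+_; _-_)
  open import Data.Integer.DivMod using (n%ℕd<d)
  open import Data.Integer.Divisibility.Signed using (∣m∣n⇒∣m+n; ∣m∣n⇒∣m-n; ∣m⇒∣-m)
  open import Data.Nat.DivMod using (m<n⇒m%n≡m)
  open import Data.Vec using (lookup; tabulate)
  open import Data.Vec.Properties using (lookup∘tabulate; tabulate∘lookup; tabulate-cong)
  open ≡-Reasoning

  pos-idx : ∀ z → + n ∣ℤ pos (idx n z) - z
  pos-idx z = subst (λ r → + n ∣ℤ + r - z) (sym (FinP.toℕ-fromℕ< (n%ℕd<d z n))) (∣z%ℕd-z z n)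

  idx-pos : ∀ m → idx n (pos m) ≡ m
  idx-pos m = FinP.toℕ-injective (trans (FinP.toℕ-fromℕ< _) (m<n⇒m%n≡m (FinP.toℕ<n m)))

  idx-≡⇔ : ∀ {x y} → idx n x ≡ idx n y ⇔ + n ∣ℤ x - y
  idx-≡⇔ {x} {y} = mk⇔ to from
    where
    to : idx n x ≡ idx n y → + n ∣ℤ x - y
    to idx≡ = subst (+ n ∣ℤ_) (cancel (pos (idx n y)) x y)
      (subst (λ i → + n ∣ℤ (pos (idx n y) - y) - (pos i - x)) idx≡
        (∣m∣n⇒∣m-n (pos-idx y) (pos-idx x)))
      where
      cancel : ∀ r x y → (r - y) - (r - x) ≡ x - y
      cancel = solve-∀
    from : + n ∣ℤ x - y → idx n x ≡ idx n y
    from n∣x-y = FinP.toℕ-injective (ℤP.+-injective (ℤP.i-j≡0⇒i≡j _ _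
      (∣∧∣∣<⇒≡0 (subst (+ n ∣ℤ_) (rearrange (pos (idx n x)) (pos (idx n y)) x y)
                   (∣m∣n⇒∣m+n (∣m∣n⇒∣m-n (pos-idx x) (pos-idx y)) n∣x-y))
                (∣+a-+b∣< (FinP.toℕ<n (idx n x)) (FinP.toℕ<n (idx n y))))))
      where
      rearrange : ∀ a b x y → (a - x) - (b - y) + (x - y) ≡ a - b
      rearrange = solve-∀

  rotLine-≡⇔ : ∀ s′ k s → s′ ≡ rotLine k s ⇔ + n ∣ℤ pos s′ - (pos s + k)
  rotLine-≡⇔ s′ k s = mk⇔
    (λ s′≡ → Equivalence.to (idx-≡⇔ {pos s′} {pos s + k}) (trans (idx-pos s′) s′≡))
    (λ n∣ → trans (sym (idx-pos s′)) (Equivalence.from (idx-≡⇔ {pos s′} {pos s + k}) n∣))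

  sameOrbit-refl : ∀ {l s} → SameOrbit (l , s) (l , s)
  sameOrbit-refl {s = s} = 0 , refl , sym (trans (cong (idx n) (ℤP.+-identityʳ (pos s))) (idx-pos s))

  colour : Necklace n → ℤ → Bool
  colour l z = lookup l (idx n z)

  colour-cong : ∀ l x y → + n ∣ℤ x - y → colour l x ≡ colour l y
  colour-cong l x y n∣x-y = cong (lookup l) (Equivalence.from (idx-≡⇔ {x} {y}) n∣x-y)

  colour-pos : ∀ l m → colour l (pos m) ≡ lookup l m
  colour-pos l m = cong (lookup l) (idx-pos m)

  colour-periodic : ∀ l {d} → + n ∣ℤ d → Period (colour l) d
  colour-periodic l {d} n∣d = periodic λ z →
    colour-cong l (z + d) z (subst (+ n ∣ℤ_) (cancel z d) n∣d)
    where
    cancel : ∀ z d → d ≡ z + d - z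
    cancel = solve-∀

  necklace-ext : ∀ {l₁ l₂} → (∀ z → colour l₁ z ≡ colour l₂ z) → l₁ ≡ l₂
  necklace-ext {l₁} {l₂} same = begin
    l₁                   ≡⟨ tabulate∘lookup l₁ ⟨
    tabulate (lookup l₁) ≡⟨ tabulate-cong (λ m → begin
      lookup l₁ m          ≡⟨ colour-pos l₁ m ⟨
      colour l₁ (pos m)    ≡⟨ same (pos m) ⟩
      colour l₂ (pos m)    ≡⟨ colour-pos l₂ m ⟩
      lookup l₂ m          ∎) ⟩
    tabulate (lookup l₂) ≡⟨ tabulate∘lookup l₂ ⟩
    l₂                   ∎

  colour-rotN : ∀ t l z → colour (rotN t l) z ≡ colour l (z - + t)
  colour-rotN zero    l z = cong (colour l) (sym (ℤP.+-identityʳ z))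
  colour-rotN (suc t) l z = begin
    colour (rot (rotN t l)) z               ≡⟨ lookup∘tabulate _ (idx n z) ⟩
    colour (rotN t l) (pos (idx n z) - + 1) ≡⟨ colour-rotN t l (pos (idx n z) - + 1) ⟩
    colour l (pos (idx n z) - + 1 - + t)    ≡⟨ colour-cong l (pos (idx n z) - + 1 - + t) (z - + suc t) n∣ ⟩
    colour l (z - + suc t)                  ∎
    where
    shift : ∀ a z t → a - z ≡ (a - + 1 - t) - (z - (+ 1 + t))
    shift = solve-∀
    n∣ : + n ∣ℤ (pos (idx n z) - + 1 - + t) - (z - + suc t)
    n∣ = subst (+ n ∣ℤ_) (shift (pos (idx n z)) z (+ t)) (pos-idx z)

  colour-flip : ∀ l z → colour (flip l) z ≡ colour l (- z)
  colour-flip l z = trans (lookup∘tabulate _ (idx n z)) (colour-cong l (- pos (idx n z)) (- z)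
    (subst (+ n ∣ℤ_) (negate (pos (idx n z)) z) (∣m⇒∣-m (pos-idx z))))
    where
    negate : ∀ a z → - (a - z) ≡ - a - - z
    negate = solve-∀

  rotN-+ : ∀ u t l → rotN u (rotN t l) ≡ rotN (u Nat.+ t) l
  rotN-+ zero    t l = refl
  rotN-+ (suc u) t l = cong rot (rotN-+ u t l)

  rotN-≡⇔ : ∀ l t₁ t₂ → rotN t₁ l ≡ rotN t₂ l ⇔ Period (colour l) (+ t₁ - + t₂)
  rotN-≡⇔ l t₁ t₂ = mk⇔ to from
    where
    to : rotN t₁ l ≡ rotN t₂ l → Period (colour l) (+ t₁ - + t₂)
    to r₁≡r₂ = periodic λ z → begin
      colour l (z + (+ t₁ - + t₂))  ≡⟨ cong (colour l) (shift z (+ t₁) (+ t₂)) ⟩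
      colour l (z + + t₁ - + t₂)    ≡⟨ colour-rotN t₂ l (z + + t₁) ⟨
      colour (rotN t₂ l) (z + + t₁) ≡⟨ cong (λ l′ → colour l′ (z + + t₁)) r₁≡r₂ ⟨
      colour (rotN t₁ l) (z + + t₁) ≡⟨ colour-rotN t₁ l (z + + t₁) ⟩
      colour l (z + + t₁ - + t₁)    ≡⟨ cong (colour l) (cancel z (+ t₁)) ⟩
      colour l z                    ∎
      where
      shift : ∀ z a b → z + (a - b) ≡ z + a - b
      shift = solve-∀
      cancel : ∀ z a → z + a - a ≡ z
      cancel = solve-∀
    from : Period (colour l) (+ t₁ - + t₂) → rotN t₁ l ≡ rotN t₂ l
    from (periodic shift) = necklace-ext λ z → begin
      colour (rotN t₁ l) z                ≡⟨ colour-rotN t₁ l z ⟩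
      colour l (z - + t₁)                 ≡⟨ shift (z - + t₁) ⟨
      colour l (z - + t₁ + (+ t₁ - + t₂)) ≡⟨ cong (colour l) (cancel z (+ t₁) (+ t₂)) ⟩
      colour l (z - + t₂)                 ≡⟨ colour-rotN t₂ l z ⟨
      colour (rotN t₂ l) z                ∎
      where
      cancel : ∀ z a b → z - a + (a - b) ≡ z - b
      cancel = solve-∀

  isAxis⇔ : ∀ l s → IsAxis l s ⇔ Axis (colour l) (pos s)
  isAxis⇔ l s = mk⇔ to from
    where
    to : IsAxis l s → Axis (colour l) (pos s)
    to s-axis = axis λ z → begin
      colour l (pos s - z)           ≡⟨ colour-cong l (pos s - z) (pos s - pos (idx n z)) (n∣ z) ⟩
      lookup l (reflect s (idx n z)) ≡⟨ ≡true⇔⇒≡ (s-axis (idx n z)) ⟨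
      colour l z                     ∎
      where
      shift : ∀ s a z → a - z ≡ (s - z) - (s - a)
      shift = solve-∀
      n∣ : ∀ z → + n ∣ℤ (pos s - z) - (pos s - pos (idx n z))
      n∣ z = subst (+ n ∣ℤ_) (shift (pos s) (pos (idx n z)) z) (pos-idx z)
    from : Axis (colour l) (pos s) → IsAxis l s
    from (axis s-axis) m = mk⇔ (trans reflected≡) (trans (sym reflected≡))
      where
      reflected≡ : lookup l (reflect s m) ≡ lookup l m
      reflected≡ = trans (s-axis (pos m)) (colour-pos l m)

module Orbit (n : ℕ) .{{_ : NonZero n}} (l : Necklace n) where
  open import Data.Integer using (_+_; _-_; _*_)
  open import Data.Integer.Divisibility.Signed
    using (∣-refl; ∣-trans; ∣m∣n⇒∣m+n; ∣m∣n⇒∣m-n; ∣n⇒∣m*n; *-monoʳ-∣; ∣⇒∣ᵤ)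
  open Necklaces n
  open Periodic (colour l)
  open ≡-Reasoning

  opaque
    leastRotation : ∃ λ m → rotN (suc m) l ≡ l × (∀ {k} → k Nat.< m → rotN (suc k) l ≢ l)
    leastRotation = leastWitness (λ k → ≡-dec _≟ᵇ_ (rotN (suc k) l) l) {Nat.pred n}
      (subst (λ t → rotN t l ≡ l) (sym (NatP.suc-pred n)) rotN-n)
      where
      rotN-n : rotN n l ≡ rotN 0 l
      rotN-n = Equivalence.from (rotN-≡⇔ l n 0)
        (colour-periodic l (∣m∣n⇒∣m-n ∣-refl (divides 0ℤ refl)))

  p₀ : ℕ
  p₀ = suc (proj₁ leastRotation)

  p₀-periodic : Period (colour l) (+ p₀)
  p₀-periodic = subst (Period (colour l)) (ℤP.+-identityʳ (+ p₀))
    (Equivalence.to (rotN-≡⇔ l p₀ 0) (proj₁ (proj₂ leastRotation)))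

  period⇔∣ : ∀ {d} → Period (colour l) d ⇔ + p₀ ∣ℤ d
  period⇔∣ = mk⇔ (period⇒∣ p₀-periodic minimal) (∣⇒period p₀-periodic)
    where
    minimal : ∀ {k} → k Nat.< proj₁ leastRotation → ¬ Period (colour l) (+ suc k)
    minimal k<m k-periodic = proj₂ (proj₂ leastRotation) k<m (Equivalence.from (rotN-≡⇔ l (suc _) 0)
      (subst (Period (colour l)) (sym (ℤP.+-identityʳ _)) k-periodic))

  rotN-≡⇔∣ : ∀ t₁ t₂ → rotN t₁ l ≡ rotN t₂ l ⇔ + p₀ ∣ℤ + t₁ - + t₂
  rotN-≡⇔∣ t₁ t₂ = period⇔∣ ⇔-∘ rotN-≡⇔ l t₁ t₂

  p₀∣n : + p₀ ∣ℤ + n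
  p₀∣n = Equivalence.to period⇔∣ (colour-periodic l ∣-refl)

  period≡p₀ : period l ≡ p₀
  period≡p₀ = trans (length-deduplicate (≡-dec _≟ᵇ_) distinct same-elements)
                    (length-applyUpTo (λ t → rotN t l) p₀)
    where
    orbit : List (Necklace n)
    orbit = applyUpTo (λ t → rotN t l) p₀
    distinct : Unique orbit
    distinct = applyUpTo⁺₁ (λ t → rotN t l) p₀ λ {i} {j} i<j j<p₀ rᵢ≡rⱼ → NatP.<⇒≢ i<j
      (ℤP.+-injective (ℤP.i-j≡0⇒i≡j (+ i) (+ j)
        (∣∧∣∣<⇒≡0 (Equivalence.to (rotN-≡⇔∣ i j) rᵢ≡rⱼ) (∣+a-+b∣< (NatP.<-trans i<j j<p₀) j<p₀))))
    reduce : ∀ t → rotN t l ∈ orbit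
    reduce t = subst (_∈ orbit) (Equivalence.from (rotN-≡⇔∣ (t Nat.% p₀) t) (∣z%ℕd-z (+ t) p₀))
      (∈-applyUpTo⁺ (λ t → rotN t l) (NatDivMod.m%n<n t p₀))
    p₀≤n : p₀ Nat.≤ n
    p₀≤n = NatDiv.∣⇒≤ (∣⇒∣ᵤ p₀∣n)
    ⊆orbit : ∀ {x} → x ∈ map (λ t → rotN t l) (upTo n) → x ∈ orbit
    ⊆orbit x∈ with t , _ , refl ← ∈-map⁻ (λ t → rotN t l) x∈ = reduce t
    orbit⊆ : ∀ {x} → x ∈ orbit → x ∈ map (λ t → rotN t l) (upTo n)
    orbit⊆ x∈ with t , t<p₀ , refl ← ∈-applyUpTo⁻ (λ t → rotN t l) x∈ =
      ∈-map⁺ (λ t → rotN t l) (∈-upTo⁺ (NatP.<-≤-trans t<p₀ p₀≤n))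
    same-elements : ∀ {x} → x ∈ map (λ t → rotN t l) (upTo n) ⇔ x ∈ orbit
    same-elements = mk⇔ ⊆orbit orbit⊆

  baseAxis : ℕ → Fin n → ℤ
  baseAxis t s = pos s - + 2 * + t

  sameOrbit⇔ : ∀ t₁ s₁ t₂ s₂ → SameOrbit (rotN t₁ l , s₁) (rotN t₂ l , s₂) ⇔
               baseAxis t₂ s₂ - baseAxis t₁ s₁ ∈⟨ + 2 * + p₀ , + n ⟩
  sameOrbit⇔ t₁ s₁ t₂ s₂ = mk⇔ to from
    where
    to : SameOrbit (rotN t₁ l , s₁) (rotN t₂ l , s₂) →
         baseAxis t₂ s₂ - baseAxis t₁ s₁ ∈⟨ + 2 * + p₀ , + n ⟩
    to (u , r₂≡ , s₂≡) =
      subst (_∈⟨ + 2 * + p₀ , + n ⟩) (rearrange (pos s₁) (pos s₂) (+ t₁) (+ t₂) (+ u))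
        (∈⟨⟩-+ (∈⟨⟩ˡ (*-monoʳ-∣ (+ 2) p₀∣u+t₁-t₂)) (∈⟨⟩ʳ n∣s₂-[s₁+2u]))
      where
      rearrange : ∀ s₁ s₂ t₁ t₂ u →
        + 2 * (u + t₁ - t₂) + (s₂ - (s₁ + + 2 * u)) ≡ (s₂ - + 2 * t₂) - (s₁ - + 2 * t₁)
      rearrange = solve-∀
      p₀∣u+t₁-t₂ : + p₀ ∣ℤ + u + + t₁ - + t₂
      p₀∣u+t₁-t₂ = subst (λ a → + p₀ ∣ℤ a - + t₂) (ℤP.pos-+ u t₁)
        (Equivalence.to (rotN-≡⇔∣ (u Nat.+ t₁) t₂) (sym (trans r₂≡ (rotN-+ u t₁ l))))
      n∣s₂-[s₁+2u] : + n ∣ℤ pos s₂ - (pos s₁ + + 2 * + u)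
      n∣s₂-[s₁+2u] = subst (λ a → + n ∣ℤ pos s₂ - (pos s₁ + a)) (ℤP.pos-* 2 u)
        (Equivalence.to (rotLine-≡⇔ s₂ (+ (2 Nat.* u)) s₁) s₂≡)
    from : baseAxis t₂ s₂ - baseAxis t₁ s₁ ∈⟨ + 2 * + p₀ , + n ⟩ →
           SameOrbit (rotN t₁ l , s₁) (rotN t₂ l , s₂)
    from (combination x y b₂-b₁≡) = u , r₂≡ , s₂≡
      where
      c : ℤ
      c = x * + p₀ - + t₁ + + t₂
      u : ℕ
      u = toℕ (idx n c)
      n∣u-c : + n ∣ℤ + u - c
      n∣u-c = pos-idx c
      r₂≡ : rotN t₂ l ≡ rotN u (rotN t₁ l)
      r₂≡ = trans (Equivalence.from (rotN-≡⇔∣ t₂ (u Nat.+ t₁)) p₀∣t₂-[u+t₁]) (sym (rotN-+ u t₁ l))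
        where
        split : ∀ v t₁ t₂ u → (- v) - (u - (v - t₁ + t₂)) ≡ t₂ - (u + t₁)
        split = solve-∀
        p₀∣t₂-[u+t₁] : + p₀ ∣ℤ + t₂ - + (u Nat.+ t₁)
        p₀∣t₂-[u+t₁] = subst (λ a → + p₀ ∣ℤ + t₂ - a) (sym (ℤP.pos-+ u t₁))
          (subst (+ p₀ ∣ℤ_) (split (x * + p₀) (+ t₁) (+ t₂) (+ u))
            (∣m∣n⇒∣m-n (divides (- x) (ℤP.neg-distribˡ-* x (+ p₀))) (∣-trans p₀∣n n∣u-c)))
      s₂≡ : s₂ ≡ rotLine (+ (2 Nat.* u)) s₁
      s₂≡ = Equivalence.from (rotLine-≡⇔ s₂ (+ (2 Nat.* u)) s₁)
        (subst (λ a → + n ∣ℤ pos s₂ - (pos s₁ + a)) (sym (ℤP.pos-* 2 u))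
          (subst (+ n ∣ℤ_) (rearrange (pos s₁) (pos s₂) (+ t₁) (+ t₂) (+ u) x (+ p₀))
            (∣m∣n⇒∣m-n n∣b₂-b₁-2xp₀ (∣n⇒∣m*n (+ 2) n∣u-c))))
        where
        cancel : ∀ a b → a + b - a ≡ b
        cancel = solve-∀
        rearrange : ∀ s₁ s₂ t₁ t₂ u x p →
          ((s₂ - + 2 * t₂) - (s₁ - + 2 * t₁)) - x * (+ 2 * p) - + 2 * (u - (x * p - t₁ + t₂))
            ≡ s₂ - (s₁ + + 2 * u)
        rearrange = solve-∀
        n∣b₂-b₁-2xp₀ : + n ∣ℤ (baseAxis t₂ s₂ - baseAxis t₁ s₁) - x * (+ 2 * + p₀)
        n∣b₂-b₁-2xp₀ = divides y
          (trans (cong (_- x * (+ 2 * + p₀)) b₂-b₁≡) (cancel (x * (+ 2 * + p₀)) (y * + n)))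

  base : AxisPair l → ℤ
  base ((_ , s) , (t , _) , _) = baseAxis t s

  axis-base : ∀ A → Axis (colour l) (base A)
  axis-base ((_ , s) , (t , refl) , s-axis) =
    axis-translate (+ t) (colour-rotN t l) (Equivalence.to (isAxis⇔ (rotN t l) s) s-axis)

  sameAxis⇔ : ∀ A B → SameAxis A B ⇔ base B - base A ∈⟨ + 2 * + p₀ , + n ⟩
  sameAxis⇔ ((_ , s₁) , (t₁ , refl) , _) ((_ , s₂) , (t₂ , refl) , _) = sameOrbit⇔ t₁ s₁ t₂ s₂

  realizes⇒∈⟨⟩ : ∀ A B k → Realizes A B k → k - (base B - base A) ∈⟨ + 2 * + p₀ , + n ⟩
  realizes⇒∈⟨⟩ ((_ , s₁) , (t₁ , refl) , _) ((_ , s₂) , (t₂ , refl) , _) k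
               (_ , σ₁ , σ₂ , A~@(u , refl , _) , B~ , σ₂≡) =
    subst (_∈⟨ + 2 * + p₀ , + n ⟩)
      (rearrange (pos σ₁) (pos σ₂) (+ t) (baseAxis t₁ s₁) (baseAxis t₂ s₂) k)
      (∈⟨⟩-- (∈⟨⟩-- (Equivalence.to (sameOrbit⇔ t₂ s₂ t σ₂) (onOrbit (rotN t₂ l , s₂) σ₂ B~))
                   (Equivalence.to (sameOrbit⇔ t₁ s₁ t σ₁) (onOrbit (rotN t₁ l , s₁) σ₁ A~)))
             (∈⟨⟩ʳ (Equivalence.to (rotLine-≡⇔ σ₂ k σ₁) σ₂≡)))
    where
    t : ℕ
    t = u Nat.+ t₁
    onOrbit : ∀ p σ → SameOrbit p (rotN u (rotN t₁ l) , σ) → SameOrbit p (rotN t l , σ)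
    onOrbit p σ = subst (λ l′ → SameOrbit p (l′ , σ)) (rotN-+ u t₁ l)
    rearrange : ∀ σ₁ σ₂ t b₁ b₂ k →
      ((σ₂ - + 2 * t) - b₂) - ((σ₁ - + 2 * t) - b₁) - (σ₂ - (σ₁ + k)) ≡ k - (b₂ - b₁)
    rearrange = solve-∀

  flip-axis : ∀ t → flip l ≡ rotN t l → Axis (colour l) (- + t)
  flip-axis t flip≡ = reflection⇒axis (+ t) λ z →
    trans (sym (colour-flip l z)) (trans (cong (λ l′ → colour l′ z) flip≡) (colour-rotN t l z))

  axis-idx : ∀ {c} → Axis (colour l) c → Axis (colour l) (pos (idx n c))
  axis-idx {c} c-axis = subst (Axis (colour l)) (cancel c (pos (idx n c)))
    (axis-period c-axis (colour-periodic l (pos-idx c)))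
    where
    cancel : ∀ c a → c + (a - c) ≡ a
    cancel = solve-∀

  axisPair : ∀ c → Axis (colour l) c → AxisPair l
  axisPair c c-axis =
    (l , idx n c) , (0 , refl) , Equivalence.from (isAxis⇔ l (idx n c)) (axis-idx c-axis)

  uniqueAxis : ∀ h → n ≡ suc (2 Nat.* h) Nat.* p₀ → ∀ A B → SameAxis A B
  uniqueAxis h n≡[1+2h]p₀ A B = Equivalence.from (sameAxis⇔ A B)
    (p∣d⇒d∈⟨2p,[1+2h]p⟩ (+ h) n≡ (Equivalence.to period⇔∣ (axis-axis (axis-base B) (axis-base A))))
    where
    n≡ : + n ≡ (+ 1 + + 2 * + h) * + p₀
    n≡ = trans (cong +_ n≡[1+2h]p₀)
      (trans (ℤP.pos-* (suc (2 Nat.* h)) p₀) (cong (λ m → (+ 1 + m) * + p₀) (ℤP.pos-* 2 h)))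

  2∣quotient⇒2p₀∣n : ∀ {q} → n ≡ q Nat.* p₀ → 2 NatDiv.∣ q → + 2 * + p₀ ∣ℤ + n
  2∣quotient⇒2p₀∣n {q} n≡qp₀ (NatDiv.divides h q≡h*2) = divides (+ h) (begin
    + n                    ≡⟨ cong +_ (trans n≡qp₀ (cong (Nat._* p₀) q≡h*2)) ⟩
    + (h Nat.* 2 Nat.* p₀) ≡⟨ ℤP.pos-* (h Nat.* 2) p₀ ⟩
    + (h Nat.* 2) * + p₀   ≡⟨ cong (_* + p₀) (ℤP.pos-* h 2) ⟩
    + h * + 2 * + p₀       ≡⟨ ℤP.*-assoc (+ h) (+ 2) (+ p₀) ⟩
    + h * (+ 2 * + p₀)     ∎)

  module CandidateAxes {c} (c-axis : Axis (colour l) c) where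

    A₁ : AxisPair l
    A₁ = axisPair c c-axis

    A₂ : AxisPair l
    A₂ = axisPair (pos (idx n c) + + p₀) (axis-period (axis-idx c-axis) p₀-periodic)

    shifted : + n ∣ℤ base A₂ - (base A₁ + + p₀)
    shifted = subst (+ n ∣ℤ_) (rearrange (pos (idx n c)) (pos (idx n (pos (idx n c) + + p₀))) (+ p₀))
      (pos-idx (pos (idx n c) + + p₀))
      where
      rearrange : ∀ a b p → b - (a + p) ≡ (b - + 2 * + 0) - ((a - + 2 * + 0) + p)
      rearrange = solve-∀

    realize : Realizes A₁ A₂ (+ p₀)
    realize = l , idx n c , idx n (pos (idx n c) + + p₀) , sameOrbit-refl , sameOrbit-refl , refl

  module EvenQuotient (2p₀∣n : + 2 * + p₀ ∣ℤ + n) (A₁ A₂ : AxisPair l)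
                      (shifted : + n ∣ℤ base A₂ - (base A₁ + + p₀)) where

    ∈⟨⟩⇔2p₀∣ : ∀ {d} → d ∈⟨ + 2 * + p₀ , + n ⟩ ⇔ + 2 * + p₀ ∣ℤ d
    ∈⟨⟩⇔2p₀∣ = mk⇔ (∈⟨⟩⇒∣ ∣-refl 2p₀∣n) ∈⟨⟩ˡ

    2p₀∣Δ-p₀ : + 2 * + p₀ ∣ℤ (base A₂ - base A₁) - + p₀
    2p₀∣Δ-p₀ = subst (+ 2 * + p₀ ∣ℤ_) (rearrange (base A₁) (base A₂) (+ p₀)) (∣-trans 2p₀∣n shifted)
      where
      rearrange : ∀ a₁ a₂ p → a₂ - (a₁ + p) ≡ (a₂ - a₁) - p
      rearrange = solve-∀

    distinct : ¬ SameAxis A₁ A₂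
    distinct same = contradiction (2p∣k-p⇒∣p∣≤∣k∣ {+ p₀} {0ℤ} 2p₀∣-p₀) λ ()
      where
      rearrange : ∀ Δ p → (Δ - p) - Δ ≡ 0ℤ - p
      rearrange = solve-∀
      2p₀∣-p₀ : + 2 * + p₀ ∣ℤ 0ℤ - + p₀
      2p₀∣-p₀ = subst (+ 2 * + p₀ ∣ℤ_) (rearrange (base A₂ - base A₁) (+ p₀))
        (∣m∣n⇒∣m-n 2p₀∣Δ-p₀ (Equivalence.to ∈⟨⟩⇔2p₀∣ (Equivalence.to (sameAxis⇔ A₁ A₂) same)))

    twoAxes : ∀ B → SameAxis B A₁ ⊎ SameAxis B A₂
    twoAxes B = Sum.map (Equivalence.from (sameAxis⇔ B A₁) ∘ ∈⟨⟩ˡ)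
                        (Equivalence.from (sameAxis⇔ B A₂) ∘ ∈⟨⟩ˡ ∘ toA₂)
      (p∣d⇒2p∣d⊎2p∣d-p (Equivalence.to period⇔∣ (axis-axis (axis-base A₁) (axis-base B))))
      where
      rearrange : ∀ a₁ a₂ b p → ((a₂ - a₁) - p) + ((a₁ - b) - p) + + 2 * p ≡ a₂ - b
      rearrange = solve-∀
      toA₂ : + 2 * + p₀ ∣ℤ (base A₁ - base B) - + p₀ → + 2 * + p₀ ∣ℤ base A₂ - base B
      toA₂ 2p₀∣a₁-b-p₀ = subst (+ 2 * + p₀ ∣ℤ_) (rearrange (base A₁) (base A₂) (base B) (+ p₀))
        (∣m∣n⇒∣m+n (∣m∣n⇒∣m+n 2p₀∣Δ-p₀ 2p₀∣a₁-b-p₀) ∣-refl)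

    realized⇒p₀≤ : ∀ k → Realizes A₁ A₂ k → p₀ Nat.≤ ∣ k ∣
    realized⇒p₀≤ k realized = 2p∣k-p⇒∣p∣≤∣k∣ {+ p₀} {k}
      (subst (+ 2 * + p₀ ∣ℤ_) (rearrange (base A₁) (base A₂) k (+ p₀))
        (∣m∣n⇒∣m+n (Equivalence.to ∈⟨⟩⇔2p₀∣ (realizes⇒∈⟨⟩ A₁ A₂ k realized)) 2p₀∣Δ-p₀))
      where
      rearrange : ∀ a₁ a₂ k p → (k - (a₂ - a₁)) + ((a₂ - a₁) - p) ≡ k - p
      rearrange = solve-∀

-- Opened only now: above, the integer operators of the same names are opened module by module.
open import Data.Nat using (_*_; _≤_)
open import Data.Nat.Divisibility using (_∣_)

lemma3p12 : (n : ℕ) → .{{_ : NonZero n}} → (j : ℕ) → j ≤ n →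
    (l : Necklace n) → blues l ≡ j → FlipInvariant l →
    (q : ℕ) → n ≡ q * period l →
      ((¬ (2 ∣ q)) →
        Σ (AxisPair l) λ A → ∀ (B : AxisPair l) → SameAxis B A)
    × ((2 ∣ q) →
        Σ (AxisPair l) λ A₁ → Σ (AxisPair l) λ A₂ →
          (¬ SameAxis A₁ A₂) × (∀ (B : AxisPair l) → SameAxis B A₁ ⊎ SameAxis B A₂)
          × TwiceDistance A₁ A₂ (period l))
lemma3p12 n _ _ l _ (t₀ , flip≡) q n≡qπ =
    (λ ¬2∣q → let h , q≡1+2h = ¬2∣⇒≡1+2* ¬2∣q in
      A₁ , λ B → uniqueAxis h (trans n≡qp₀ (cong (_* p₀) q≡1+2h)) B A₁)
  , (λ 2∣q → let open EvenQuotient (2∣quotient⇒2p₀∣n n≡qp₀ 2∣q) A₁ A₂ shifted in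
      A₁ , A₂ , distinct , twoAxes ,
      subst (TwiceDistance A₁ A₂) (sym period≡p₀) ((+ p₀ , realize , refl) , realized⇒p₀≤))
  where
  open Orbit n l
  open CandidateAxes (flip-axis t₀ flip≡)
  n≡qp₀ : n ≡ q * p₀
  n≡qp₀ = trans n≡qπ (cong (q *_) period≡p₀)
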